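{- Let $\mathbb{K}$ be a field of characteristic zero, let $T(f\mid g)$ be an element of the Riordan group with $g=\sum_{n\geq0}g_nx^n$, and let $(p_n(x))$ be its associated family of polynomials. Let $h=\sum_{n\ge0}h_nx^n\in\mathbb{K}[[x]]$ be Hadamard invertible (i.e. $h_n\neq0$ for all $n$). Then the derivative $\mathcal{D}(h)$ is Hadamard invertible and, for all $n\geq1$, \[ p_{n-1}^{\mathcal{D}(h)}(x)=\sum_{k=0}^{n}g_k\,\mathcal{D}\big(p_{n-k}^h\big)(x), \] where for a series $u$ we write $p_n^u(x)=p_n(x)\star u(x)$.
   Context: For $f,g\in\mathbb{K}[[x]]$ with $g(0)\neq0$, $T(f\mid g)$ is the infinite lower triangular matrix whose $k$-th column has generating function $\frac{f(x)}{g(x)}\left(\frac{x}{g(x)}\right)^k$; the Riordan group is the set of such matrices with $f(0)\neq0$, $g(0)\neq0$. The associated family of polynomials of a lower triangular matrix $(a_{n,j})$ is $p_n(x)=\sum_{j=0}^n a_{n,j}x^j$. $\star$ denotes the Hadamard product $\left(\sum a_nx^n\right)\star\left(\sum b_nx^n\right)=\sum a_nb_nx^n$, and $\mathcal{D}$ denotes formal differentiation with respect to $x$. -}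

module Defs where

open import Level using (Level; suc; _⊔_)
open import Data.Nat as ℕ using (ℕ; zero; _∸_; _≤ᵇ_)
open import Data.Bool using (if_then_else_)
open import Relation.Nullary using (¬_)
open import Algebra.Bundles using (CommutativeRing)

-- A field: a commutative ring with 1 ≉ 0 in which every nonzero element
-- has a multiplicative inverse (the inverse operation is total; its value
-- at 0 is irrelevant).
record Field (c ℓ : Level) : Set (Level.suc (c ⊔ ℓ)) where
  field
    commutativeRing : CommutativeRing c ℓ
  open CommutativeRing commutativeRing public
  field
    _⁻¹      : Carrier → Carrier
    1≉0      : ¬ (1# ≈ 0#)
    inverseʳ : ∀ x → ¬ (x ≈ 0#) → (x * (x ⁻¹)) ≈ 1#

  fromℕ : ℕ → Carrier
  fromℕ zero      = 0#
  fromℕ (ℕ.suc n) = 1# + fromℕ n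

CharZero : ∀ {c ℓ} → Field c ℓ → Set ℓ
CharZero F = ∀ n → ¬ (fromℕ (ℕ.suc n) ≈ 0#)
  where open Field F

module Series {c ℓ} (F : Field c ℓ) where
  open Field F

  PS : Set c
  PS = ℕ → Carrier

  sumTo : ℕ → (ℕ → Carrier) → Carrier
  sumTo zero      a = a 0
  sumTo (ℕ.suc n) a = sumTo n a + a (ℕ.suc n)

  _≋_ : PS → PS → Set ℓ
  u ≋ v = ∀ n → u n ≈ v n

  oneS : PS
  oneS zero      = 1#
  oneS (ℕ.suc n) = 0#

  xTimes : PS → PS
  xTimes u zero      = 0#
  xTimes u (ℕ.suc n) = u n

  _·_ : PS → PS → PS
  (u · v) n = sumTo n (λ i → u i * v (n ∸ i))

  _^_ : PS → ℕ → PS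
  u ^ zero      = oneS
  u ^ ℕ.suc k   = (u ^ k) · u

  -- multiplicative inverse of a series g with g 0 ≠ 0:
  -- (1/g)_0 = g_0⁻¹,  (1/g)_N = - g_0⁻¹ Σ_{i=1}^{N} g_i (1/g)_{N-i}.
  -- invAux g n m is correct for all m ≤ n.
  invAux : PS → ℕ → PS
  invAux g zero      m = g 0 ⁻¹
  invAux g (ℕ.suc n) m =
    if m ≤ᵇ n then invAux g n m
    else - (g 0 ⁻¹) * sumTo n (λ j → g (ℕ.suc j) * invAux g n (n ∸ j))

  inv : PS → PS
  inv g n = invAux g n n

  T : PS → PS → ℕ → ℕ → Carrier
  T f g n k = ((f · inv g) · (xTimes (inv g) ^ k)) n

  -- associated polynomials p_n(x) = Σ_{j ≤ n} T(n,j) x^j (as coefficient sequences;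
  -- entries with j > n are the (zero) entries above the diagonal)
  poly : PS → PS → ℕ → PS
  poly f g n j = T f g n j

  _⋆_ : PS → PS → PS
  (u ⋆ v) n = u n * v n

  polyH : PS → PS → PS → ℕ → PS
  polyH f g u n = poly f g n ⋆ u

  D : PS → PS
  D u n = fromℕ (ℕ.suc n) * u (ℕ.suc n)

  HadamardInvertible : PS → Set ℓ
  HadamardInvertible u = ∀ n → ¬ (u n ≈ 0#)

module Submission where

-- Write C_k = (f/g)·(x/g)^k for the k-th column of T(f | g), so that
-- [x^n] C_k = T(n,k).  Since C_{k+1} = C_k · (x/g) and g · (x/g) = x, the
-- columns satisfy  g · C_{k+1} = x · C_k; reading off the coefficient of
-- x^{m+1} gives the row recurrence
--     T(m, j) = Σ_{k ≤ m+1} g_k T(m+1-k, j+1).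
-- The j-th coefficient of p_m^{D h} is T(m,j)·(j+1)h_{j+1}, and that of
-- D(p_n^h) is (j+1)·T(n,j+1)h_{j+1}; so the theorem is the row recurrence
-- multiplied by the weight (j+1)h_{j+1}.  Hadamard invertibility of D h
-- holds because (n+1) ≠ 0 in characteristic zero and fields have no zero
-- divisors.

open import Defs
open import Data.Nat using (ℕ; suc; _∸_)
open import Data.Product using (_×_)
open import Relation.Nullary using (¬_)

open import Data.Nat using (zero; _≤_; z≤n; _≤ᵇ_; _<ᵇ_; _≤?_) renaming (_+_ to _+ℕ_)
import Data.Nat.Properties as ℕₚ
open import Data.Bool using (true; false; if_then_else_) renaming (T to True)
open import Data.Product using (_,_)
open import Relation.Nullary using (yes; no)
open import Relation.Binary.Bundles using (Setoid)
import Relation.Binary.PropositionalEquality as P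
import Relation.Binary.Reasoning.Setoid as SetoidReasoning

module Proof {c ℓ} (F : Field c ℓ) where
  open Field F hiding (zero)
  open Series F
  open import Algebra.Properties.Ring ring using (-1*x≈-x; -‿distribʳ-*)
  open import Algebra.Properties.CommutativeSemigroup +-commutativeSemigroup
    using () renaming (interchange to +-interchange)
  open import Algebra.Properties.CommutativeSemigroup *-commutativeSemigroup
    using (x∙yz≈y∙xz)
  module ≈-Reasoning = SetoidReasoning setoid

  ≡⇒≈ : ∀ {x y} → x P.≡ y → x ≈ y
  ≡⇒≈ P.refl = refl

  sumTo-cong : ∀ n {a b : ℕ → Carrier} → (∀ i → i ≤ n → a i ≈ b i) →
               sumTo n a ≈ sumTo n b
  sumTo-cong zero    eq = eq 0 z≤n
  sumTo-cong (suc n) eq =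
    +-cong (sumTo-cong n (λ i i≤n → eq i (ℕₚ.m≤n⇒m≤1+n i≤n))) (eq (suc n) ℕₚ.≤-refl)

  sumTo-shift : ∀ n a → sumTo (suc n) a ≈ a 0 + sumTo n (λ i → a (suc i))
  sumTo-shift zero    a = refl
  sumTo-shift (suc n) a = begin
    sumTo (suc n) a + a (suc (suc n))                   ≈⟨ +-cong (sumTo-shift n a) refl ⟩
    (a 0 + sumTo n (λ i → a (suc i))) + a (suc (suc n)) ≈⟨ +-assoc _ _ _ ⟩
    a 0 + (sumTo n (λ i → a (suc i)) + a (suc (suc n))) ∎
    where open ≈-Reasoning

  sumTo-+ : ∀ n a b → sumTo n (λ i → a i + b i) ≈ sumTo n a + sumTo n b
  sumTo-+ zero    a b = refl
  sumTo-+ (suc n) a b = trans (+-cong (sumTo-+ n a b) refl) (+-interchange _ _ _ _)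

  sumTo-*ˡ : ∀ n x a → x * sumTo n a ≈ sumTo n (λ i → x * a i)
  sumTo-*ˡ zero    x a = refl
  sumTo-*ˡ (suc n) x a = trans (distribˡ _ _ _) (+-cong (sumTo-*ˡ n x a) refl)

  sumTo-*ʳ : ∀ n x a → sumTo n a * x ≈ sumTo n (λ i → a i * x)
  sumTo-*ʳ zero    x a = refl
  sumTo-*ʳ (suc n) x a = trans (distribʳ _ _ _) (+-cong (sumTo-*ʳ n x a) refl)

  sumTo-zero : ∀ n a → (∀ i → a i ≈ 0#) → sumTo n a ≈ 0#
  sumTo-zero zero    a a≈0 = a≈0 0
  sumTo-zero (suc n) a a≈0 = trans (+-cong (sumTo-zero n a a≈0) (a≈0 (suc n))) (+-identityˡ _)

  sumTo-reverse : ∀ n a → sumTo n a ≈ sumTo n (λ i → a (n ∸ i))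
  sumTo-reverse zero    a = refl
  sumTo-reverse (suc n) a = begin
    sumTo n a + a (suc n)                 ≈⟨ +-cong (sumTo-reverse n a) refl ⟩
    sumTo n (λ i → a (n ∸ i)) + a (suc n) ≈⟨ +-comm _ _ ⟩
    a (suc n) + sumTo n (λ i → a (n ∸ i)) ≈⟨ sumTo-shift n (λ i → a (suc n ∸ i)) ⟨
    sumTo (suc n) (λ i → a (suc n ∸ i))   ∎
    where open ≈-Reasoning

  sumTo-exchange : ∀ n (G : ℕ → ℕ → Carrier) →
    sumTo n (λ i → sumTo i (λ a → G a i)) ≈ sumTo n (λ a → sumTo (n ∸ a) (λ t → G a (a +ℕ t)))
  sumTo-exchange zero    G = refl
  sumTo-exchange (suc n) G = begin
    sumTo n (λ i → sumTo i (λ a → G a i)) + sumTo (suc n) (λ a → G a (suc n))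
      ≈⟨ +-cong (sumTo-exchange n G) refl ⟩
    rows n + (sumTo n (λ a → G a (suc n)) + G (suc n) (suc n))
      ≈⟨ +-assoc _ _ _ ⟨
    (rows n + sumTo n (λ a → G a (suc n))) + G (suc n) (suc n)
      ≈⟨ +-cong (sumTo-+ n _ _) (≡⇒≈ lastRow) ⟨
    sumTo n (λ a → row n a + G a (suc n)) + row (suc n) (suc n)
      ≈⟨ +-cong (sumTo-cong n (λ a a≤n → ≡⇒≈ (extendRow a a≤n))) refl ⟩
    sumTo (suc n) (row (suc n)) ∎
    where
    open ≈-Reasoning
    row : ℕ → ℕ → Carrier
    row m a = sumTo (m ∸ a) (λ t → G a (a +ℕ t))
    rows : ℕ → Carrier
    rows m = sumTo m (row m)
    lastRow : row (suc n) (suc n) P.≡ G (suc n) (suc n)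
    lastRow rewrite ℕₚ.n∸n≡0 n | ℕₚ.+-identityʳ (suc n) = P.refl
    extendRow : ∀ a → a ≤ n → row n a + G a (suc n) P.≡ row (suc n) a
    extendRow a a≤n rewrite ℕₚ.+-∸-assoc 1 a≤n =
      P.cong (λ k → row n a + G a k)
             (P.sym (P.trans (ℕₚ.+-suc a (n ∸ a)) (P.cong suc (ℕₚ.m+[n∸m]≡n a≤n))))

  seriesSetoid : Setoid c ℓ
  seriesSetoid = record
    { Carrier = PS
    ; _≈_ = _≋_
    ; isEquivalence = record
      { refl  = λ n → refl
      ; sym   = λ u≋v n → sym (u≋v n)
      ; trans = λ u≋v v≋w n → trans (u≋v n) (v≋w n)
      }
    }

  module ≋-Reasoning = SetoidReasoning seriesSetoid

  ·-cong : ∀ {u u′ v v′} → u ≋ u′ → v ≋ v′ → (u · v) ≋ (u′ · v′)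
  ·-cong u≋u′ v≋v′ n = sumTo-cong n (λ i _ → *-cong (u≋u′ i) (v≋v′ (n ∸ i)))

  ·-congˡ : ∀ u {v v′} → v ≋ v′ → (u · v) ≋ (u · v′)
  ·-congˡ u = ·-cong {u = u} (λ n → refl)

  ·-congʳ : ∀ {u u′} v → u ≋ u′ → (u · v) ≋ (u′ · v)
  ·-congʳ v u≋u′ = ·-cong {v = v} u≋u′ (λ n → refl)

  ·-comm : ∀ u v → (u · v) ≋ (v · u)
  ·-comm u v n = trans (sumTo-reverse n _) (sumTo-cong n λ i i≤n →
    trans (*-comm _ _) (*-cong (≡⇒≈ (P.cong v (ℕₚ.m∸[m∸n]≡n i≤n))) refl))

  ·-assoc : ∀ u v w → ((u · v) · w) ≋ (u · (v · w))
  ·-assoc u v w n = begin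
    sumTo n (λ i → sumTo i (λ a → u a * v (i ∸ a)) * w (n ∸ i))
      ≈⟨ sumTo-cong n (λ i _ → sumTo-*ʳ i _ _) ⟩
    sumTo n (λ i → sumTo i (λ a → u a * v (i ∸ a) * w (n ∸ i)))
      ≈⟨ sumTo-exchange n _ ⟩
    sumTo n (λ a → sumTo (n ∸ a) (λ t → u a * v ((a +ℕ t) ∸ a) * w (n ∸ (a +ℕ t))))
      ≈⟨ sumTo-cong n (λ a _ → sumTo-cong (n ∸ a) (λ t _ → reindex a t)) ⟩
    sumTo n (λ a → sumTo (n ∸ a) (λ t → u a * (v t * w ((n ∸ a) ∸ t))))
      ≈⟨ sumTo-cong n (λ a _ → sumTo-*ˡ (n ∸ a) _ _) ⟨
    sumTo n (λ a → u a * sumTo (n ∸ a) (λ t → v t * w ((n ∸ a) ∸ t))) ∎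
    where
    open ≈-Reasoning
    reindex : ∀ a t → u a * v ((a +ℕ t) ∸ a) * w (n ∸ (a +ℕ t)) ≈ u a * (v t * w ((n ∸ a) ∸ t))
    reindex a t = trans (*-cong (*-cong refl (≡⇒≈ (P.cong v (ℕₚ.m+n∸m≡n a t))))
                                (≡⇒≈ (P.cong w (P.sym (ℕₚ.∸-+-assoc n a t)))))
                        (*-assoc _ _ _)

  ·-identityˡ : ∀ u → (oneS · u) ≋ u
  ·-identityˡ u zero    = *-identityˡ _
  ·-identityˡ u (suc n) = trans (sumTo-shift n _)
    (trans (+-cong (*-identityˡ _) (sumTo-zero n _ (λ i → zeroˡ _))) (+-identityʳ _))

  xTimes-cong : ∀ {u v} → u ≋ v → xTimes u ≋ xTimes v
  xTimes-cong u≋v zero    = refl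
  xTimes-cong u≋v (suc n) = u≋v n

  ·-xTimesʳ : ∀ u v → (u · xTimes v) ≋ xTimes (u · v)
  ·-xTimesʳ u v zero    = zeroʳ _
  ·-xTimesʳ u v (suc n) = trans
    (+-cong (sumTo-cong n (λ i i≤n → *-cong refl (≡⇒≈ (P.cong (xTimes v) (ℕₚ.+-∸-assoc 1 i≤n)))))
            (trans (*-cong refl (≡⇒≈ (P.cong (xTimes v) (ℕₚ.n∸n≡0 n)))) (zeroʳ _)))
    (+-identityʳ _)

  n<ᵇn : ∀ n → (n <ᵇ n) P.≡ false
  n<ᵇn zero    = P.refl
  n<ᵇn (suc n) = n<ᵇn n

  invAux-stable : ∀ g n m → m ≤ n → invAux g n m P.≡ inv g m
  invAux-stable g zero    .zero z≤n = P.refl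
  invAux-stable g (suc n) m m≤1+n with m ≤? n
  ... | yes m≤n = P.trans (earlier (m ≤ᵇ n) (ℕₚ.≤⇒≤ᵇ m≤n)) (invAux-stable g n m m≤n)
    where
    earlier : ∀ b → True b →
      (if b then invAux g n m
       else - (g 0 ⁻¹) * sumTo n (λ j → g (suc j) * invAux g n (n ∸ j))) P.≡ invAux g n m
    earlier true _ = P.refl
  ... | no m≰n = P.subst (λ k → invAux g (suc n) k P.≡ inv g k)
                         (P.sym (ℕₚ.≤-antisym m≤1+n (ℕₚ.≰⇒> m≰n))) P.refl

  inv-suc : ∀ g n → inv g (suc n) ≈ - (g 0 ⁻¹) * sumTo n (λ i → g (suc i) * inv g (n ∸ i))
  inv-suc g n rewrite n<ᵇn n =
    *-cong refl (sumTo-cong n (λ i _ →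
      *-cong refl (≡⇒≈ (invAux-stable g n (n ∸ i) (ℕₚ.m∸n≤m n i)))))

  inv-inverseʳ : ∀ g → ¬ (g 0 ≈ 0#) → (g · inv g) ≋ oneS
  inv-inverseʳ g g0≉0 zero    = inverseʳ (g 0) g0≉0
  inv-inverseʳ g g0≉0 (suc n) = begin
    (g · inv g) (suc n)          ≈⟨ sumTo-shift n _ ⟩
    g 0 * inv g (suc n) + S      ≈⟨ +-cong (*-cong refl (inv-suc g n)) refl ⟩
    g 0 * (- (g 0 ⁻¹) * S) + S   ≈⟨ +-cong (*-assoc _ _ _) refl ⟨
    (g 0 * - (g 0 ⁻¹)) * S + S   ≈⟨ +-cong (*-cong (-‿distribʳ-* _ _) refl) refl ⟨
    (- (g 0 * g 0 ⁻¹)) * S + S   ≈⟨ +-cong (*-cong (-‿cong (inverseʳ (g 0) g0≉0)) refl) refl ⟩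
    (- 1#) * S + S               ≈⟨ +-cong (-1*x≈-x S) refl ⟩
    - S + S                      ≈⟨ -‿inverseˡ S ⟩
    0#                           ∎
    where
    open ≈-Reasoning
    S : Carrier
    S = sumTo n (λ i → g (suc i) * inv g (n ∸ i))

  cancel-x/g : ∀ g → ¬ (g 0 ≈ 0#) → ∀ u → (g · (u · xTimes (inv g))) ≋ xTimes u
  cancel-x/g g g0≉0 u = begin
    g · (u · xTimes (inv g)) ≈⟨ ·-congˡ g (·-xTimesʳ u (inv g)) ⟩
    g · xTimes (u · inv g)   ≈⟨ ·-xTimesʳ g (u · inv g) ⟩
    xTimes (g · (u · inv g)) ≈⟨ xTimes-cong g·u/g≋u ⟩
    xTimes u                 ∎
    where
    open ≋-Reasoning
    g·u/g≋u : (g · (u · inv g)) ≋ u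
    g·u/g≋u = begin
      g · (u · inv g) ≈⟨ ·-congˡ g (·-comm u (inv g)) ⟩
      g · (inv g · u) ≈⟨ ·-assoc g (inv g) u ⟨
      (g · inv g) · u ≈⟨ ·-congʳ u (inv-inverseʳ g g0≉0) ⟩
      oneS · u        ≈⟨ ·-identityˡ u ⟩
      u               ∎

  column : PS → PS → ℕ → PS
  column f g k = (f · inv g) · (xTimes (inv g) ^ k)

  -- g · C_{k+1} = x · C_k, since C_{k+1} = C_k · (x/g).
  column-recurrence : ∀ f g → ¬ (g 0 ≈ 0#) → ∀ k →
                      (g · column f g (suc k)) ≋ xTimes (column f g k)
  column-recurrence f g g0≉0 k = begin
    g · column f g (suc k)               ≈⟨ ·-congˡ g (·-assoc (f · inv g) _ (xTimes (inv g))) ⟨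
    g · (column f g k · xTimes (inv g))  ≈⟨ cancel-x/g g g0≉0 (column f g k) ⟩
    xTimes (column f g k)                ∎
    where open ≋-Reasoning

  row-recurrence : ∀ f g → ¬ (g 0 ≈ 0#) → ∀ m j →
                   T f g m j ≈ sumTo (suc m) (λ k → g k * T f g (suc m ∸ k) (suc j))
  row-recurrence f g g0≉0 m j = sym (column-recurrence f g g0≉0 j (suc m))

  *-nonzero : ∀ {x y} → ¬ (x ≈ 0#) → ¬ (y ≈ 0#) → ¬ ((x * y) ≈ 0#)
  *-nonzero {x} {y} x≉0 y≉0 xy≈0 = y≉0 (begin
    y              ≈⟨ *-identityˡ y ⟨
    1# * y         ≈⟨ *-cong (trans (sym (inverseʳ x x≉0)) (*-comm _ _)) refl ⟩
    (x ⁻¹ * x) * y ≈⟨ *-assoc _ _ _ ⟩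
    x ⁻¹ * (x * y) ≈⟨ *-cong refl xy≈0 ⟩
    x ⁻¹ * 0#      ≈⟨ zeroʳ _ ⟩
    0#             ∎)
    where open ≈-Reasoning

  -- Multiplying the row recurrence by the weight w_j = (j+1) h_{j+1} turns
  -- T(n, ·) ⋆ D h into p_n^{D h} and T(n, · + 1) ⋆ h into D(p_n^h).
  polyH-derivative : ∀ f g → ¬ (g 0 ≈ 0#) → ∀ h m j →
    polyH f g (D h) m j ≈ sumTo (suc m) (λ k → g k * D (polyH f g h (suc m ∸ k)) j)
  polyH-derivative f g g0≉0 h m j = begin
    T f g m j * w
      ≈⟨ *-cong (row-recurrence f g g0≉0 m j) refl ⟩
    sumTo (suc m) (λ k → g k * T f g (suc m ∸ k) (suc j)) * w
      ≈⟨ sumTo-*ʳ (suc m) w _ ⟩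
    sumTo (suc m) (λ k → (g k * T f g (suc m ∸ k) (suc j)) * w)
      ≈⟨ sumTo-cong (suc m) (λ k _ → moveWeight (g k) (T f g (suc m ∸ k) (suc j))) ⟩
    sumTo (suc m) (λ k → g k * (fromℕ (suc j) * (T f g (suc m ∸ k) (suc j) * h (suc j)))) ∎
    where
    open ≈-Reasoning
    w : Carrier
    w = fromℕ (suc j) * h (suc j)
    moveWeight : ∀ a t → (a * t) * w ≈ a * (fromℕ (suc j) * (t * h (suc j)))
    moveWeight a t = trans (*-assoc _ _ _) (*-cong refl (x∙yz≈y∙xz t _ _))

mainTheorem10 : ∀ {c ℓ} (F : Field c ℓ) → CharZero F →
    let open Field F
        open Series F
    in (f g : PS) → ¬ (f 0 ≈ 0#) → ¬ (g 0 ≈ 0#) →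
       (h : PS) → HadamardInvertible h →
       HadamardInvertible (D h) ×
       (∀ m j → polyH f g (D h) m j
                  ≈ sumTo (suc m) (λ k → g k * D (polyH f g h (suc m ∸ k)) j))
mainTheorem10 F charZero f g f0≉0 g0≉0 h h-invertible =
  (λ n → *-nonzero (charZero n) (h-invertible (suc n))) ,
  polyH-derivative f g g0≉0 h
  where open Proof F
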